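{- Let $H$ be a finite bipartite graph with parts $A$ and $B$ and edge set $E(H)\subseteq A\times B$, and let $\nu:V(H)\to\mathbb{R}_+$ be a vertex weight function. Let $\tilde{H}$ be the weighted graph with vertex set $E(H)$, in which $((a_1,b_1),(a_2,b_2))\in E(\tilde{H})$ if and only if $(a_1,b_2)\in E(H)$ and $(a_2,b_1)\in E(H)$ (in particular every vertex has a loop), and with vertex weights $\tilde{\nu}(a,b)=\nu(a)\nu(b)$ for $(a,b)\in E(H)$. Then for every $d\geq 1$ and every $d$-regular simple graph $G$ on $n$ vertices, $$Z(G,\tilde{H})\leq Z(K_{d+1},\tilde{H})^{n/(d+1)}.$$
   Context: For a graph $G$ and a (possibly looped) graph $F$ with vertex weight function $\mu:V(F)\to\mathbb{R}_+$, the partition function is $$Z(G,F)=\sum_{\varphi:V(G)\to V(F)}\ \prod_{(u,v)\in E(G)}\mathbb{I}_{E(F)}(\varphi(u),\varphi(v))\prod_{w\in V(G)}\mu(\varphi(w)),$$ where $\mathbb{I}_{E(F)}$ is the indicator function of the edge set of $F$; i.e. the sum over homomorphisms $G\to F$ of the product of the weights of the images of the vertices. $K_{d+1}$ is the complete graph on $d+1$ vertices.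
   Formalization: The vertex weights ν take nonnegative rational values instead of values in $\mathbb{R}_+$. -}

module Defs where

open import Data.Bool using (Bool; true; false; if_then_else_; not)
open import Data.Nat using (ℕ; zero; suc)
open import Data.Fin using (Fin; zero; suc)
open import Data.Fin.Properties using (_≟_)
open import Data.List using (List; []; _∷_; map; foldr; filter; allFin; cartesianProduct; concatMap)
open import Data.Product using (_×_; _,_; proj₁; proj₂)
open import Data.Rational using (ℚ; 0ℚ; 1ℚ; _+_; _*_; _≤_)
open import Relation.Binary.PropositionalEquality using (_≡_)
open import Relation.Nullary.Decidable using (⌊_⌋)
open import Data.Bool.Properties using () renaming (_≟_ to _≟b_)

sumℚ : List ℚ → ℚ
sumℚ = foldr _+_ 0ℚ

prodℚ : List ℚ → ℚ
prodℚ = foldr _*_ 1ℚ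

_^ℚ_ : ℚ → ℕ → ℚ
x ^ℚ zero  = 1ℚ
x ^ℚ suc k = x * (x ^ℚ k)

record SimpleGraph (n : ℕ) : Set where
  field
    adj    : Fin n → Fin n → Bool
    adj-sym    : ∀ u v → adj u v ≡ adj v u
    adj-irrefl : ∀ u → adj u u ≡ false
open SimpleGraph public

degree : ∀ {n} → SimpleGraph n → Fin n → ℕ
degree {n} G u = Data.List.length (filter (λ v → adj G u v ≟b true) (allFin n))

Regular : ∀ {n} → ℕ → SimpleGraph n → Set
Regular {n} d G = ∀ u → degree G u ≡ d

complete : (m : ℕ) → SimpleGraph m
complete m = record { adj = λ u v → not ⌊ u ≟ v ⌋ ; adj-sym = symK ; adj-irrefl = irrK }
  where
  open import Relation.Binary.PropositionalEquality using (refl; sym)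
  open import Relation.Nullary using (yes; no)
  symK : ∀ u v → not ⌊ u ≟ v ⌋ ≡ not ⌊ v ≟ u ⌋
  symK u v with u ≟ v | v ≟ u
  ... | yes _ | yes _ = refl
  ... | no _  | no _  = refl
  ... | yes p | no q  = Data.Empty.⊥-elim (q (sym p)) where import Data.Empty
  ... | no p  | yes q = Data.Empty.⊥-elim (p (sym q)) where import Data.Empty
  irrK : ∀ u → not ⌊ u ≟ u ⌋ ≡ false
  irrK u with u ≟ u
  ... | yes _ = refl
  ... | no p  = Data.Empty.⊥-elim (p refl) where import Data.Empty

-- Weighted (possibly looped) target graph F: an explicit duplicate-free list
-- of its vertices, a symmetric adjacency relation and a vertex weight.
record WGraph : Set₁ where
  field
    V      : Set
    verts  : List V
    adjF   : V → V → Bool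
    weight : V → ℚ
open WGraph public

allMaps : ∀ {V : Set} → List V → (n : ℕ) → List (Fin n → V)
allMaps xs zero    = (λ ()) ∷ []
allMaps xs (suc n) =
  concatMap (λ x → map (λ f → λ { zero → x ; (suc i) → f i }) (allMaps xs n)) xs

ind : Bool → ℚ
ind true  = 1ℚ
ind false = 0ℚ

-- Partition function Z(G,F): sum over all φ : V(G) → V(F) of
--   ∏_{(u,v) ∈ E(G)} 1_{E(F)}(φ u, φ v) · ∏_w μ(φ w)
-- (product over ordered pairs (u,v) with u ~ v; each indicator is 0/1)
Z : ∀ {n} → SimpleGraph n → WGraph → ℚ
Z {n} G F = sumℚ (map term (allMaps (verts F) n))
  where
  term : (Fin n → V F) → ℚ
  term φ = prodℚ (concatMap (λ u → map (λ v → if adj G u v then ind (adjF F (φ u) (φ v)) else 1ℚ) (allFin n)) (allFin n))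
         * prodℚ (map (λ w → weight F (φ w)) (allFin n))

Htilde : (p q : ℕ) → (Fin p → Fin q → Bool) → (Fin p → ℚ) → (Fin q → ℚ) → WGraph
Htilde p q E νA νB = record
  { V      = Fin p × Fin q
  ; verts  = filter (λ ab → E (proj₁ ab) (proj₂ ab) ≟b true) (cartesianProduct (allFin p) (allFin q))
  ; adjF   = λ x y → Data.Bool._∧_ (E (proj₁ x) (proj₂ y)) (E (proj₁ y) (proj₂ x))
  ; weight = λ ab → νA (proj₁ ab) * νB (proj₂ ab)
  }
  where import Data.Bool

{-# OPTIONS --safe #-}

-- Write a map φ : V(G) → V(H̃) as a pair of labellings α : V(G) → A and β : V(G) → B.  The
-- conditions defining H̃ say exactly that E (α a) (β v) holds for every v in the closed
-- neighbourhood N[a]; so once β is fixed the A-labels are independent, and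
--   Z(G, H̃) = ∑_β ν(β) ∏_a f_a(β),   f_a(β) = ∑_x ν(x) [E x (β v) for all v ∈ N[a]].
-- In a d-regular graph every vertex lies in exactly d + 1 closed neighbourhoods, so Finner's
-- inequality (an iterated Hölder inequality, here proved without roots from AM-GM) bounds
-- Z(G, H̃)^(d+1) by ∏_a ∑_{β on N[a]} ν(β) f_a(β)^(d+1); each factor equals Z(K_{d+1}, H̃).

module Submission where

open import Defs
open import Data.Nat using (ℕ; suc; _≤_)
open import Data.Fin using (Fin)
open import Data.Bool using (Bool)
open import Data.Rational using (ℚ; 0ℚ) renaming (_≤_ to _≤ℚ_)

open import Algebra.Bundles using (CommutativeMonoid)
open import Data.Bool using (true; false; not; if_then_else_; _∧_; _∨_; T; T?)
open import Data.Bool.Properties using (T-≡) renaming (_≟_ to _≟ᵇ_)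
open import Data.Empty using (⊥-elim)
open import Data.Fin using (zero; suc; toℕ)
open import Data.Fin.Permutation using (Permutation; _⟨$⟩ʳ_; _⟨$⟩ˡ_; permutation; inverseˡ; flip)
open import Data.Fin.Properties as Fin using (_≟_)
open import Data.List as L using (List; []; _∷_; _++_; foldr; filterᵇ; allFin; length)
import Data.List.Properties as L
open import Data.Nat as ℕ using (zero)
import Data.Nat.Properties as ℕ
open import Data.Nat.DivMod using (_mod_; _%_; %-distribˡ-+; m%n%n≡m%n; [m+n]%n≡m%n; m<n⇒m%n≡m)
open import Data.Product using (_×_; _,_; <_,_>; uncurry)
open import Data.Rational using (1ℚ; _+_; _*_; _-_; -_; _<_; _≤?_; nonNegative; positive)
import Data.Rational.Properties as ℚ
open import Data.Rational.Solver using (module +-*-Solver)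
open import Data.Sum using (inj₁; inj₂)
open import Data.Unit using (tt)
open import Data.Vec.Functional using () renaming (_∷_ to cons)
open import Function using (_∘_; id)
open import Function.Bundles using (Equivalence)
import Relation.Binary.PropositionalEquality as ≡
open import Relation.Nullary using (yes; no; contradiction)
open import Relation.Nullary.Decidable using (⌊_⌋)

open +-*-Solver

-- Big operators

module BigOperator {c ℓ} (M : CommutativeMonoid c ℓ) where
  open CommutativeMonoid M
    using (setoid; _≈_; _∙_; ε; ∙-cong; ∙-congˡ; identityˡ; assoc; refl; sym; trans; reflexive; commutativeSemigroup)
    renaming (Carrier to R)
  open import Relation.Binary.Reasoning.Setoid setoid
  open import Algebra.Properties.CommutativeSemigroup commutativeSemigroup using (interchange; x∙yz≈y∙xz)
  import Algebra.Properties.CommutativeMonoid.Sum M as Vector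

  ⨁ : {A : Set} → List A → (A → R) → R
  ⨁ xs f = foldr _∙_ ε (L.map f xs)

  module _ {A : Set} where

    cong : ∀ xs {f g : A → R} → (∀ x → f x ≈ g x) → ⨁ xs f ≈ ⨁ xs g
    cong []       f≈g = refl
    cong (x ∷ xs) f≈g = ∙-cong (f≈g x) (cong xs f≈g)

    constant-ε : ∀ xs → ⨁ xs (λ (_ : A) → ε) ≈ ε
    constant-ε []       = refl
    constant-ε (x ∷ xs) = trans (identityˡ _) (constant-ε xs)

    distrib : ∀ xs (f g : A → R) → ⨁ xs (λ x → f x ∙ g x) ≈ ⨁ xs f ∙ ⨁ xs g
    distrib []       f g = sym (identityˡ ε)
    distrib (x ∷ xs) f g = trans (∙-congˡ (distrib xs f g)) (interchange (f x) (g x) _ _)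

    ++ : ∀ xs ys (f : A → R) → ⨁ (xs ++ ys) f ≈ ⨁ xs f ∙ ⨁ ys f
    ++ []       ys f = sym (identityˡ _)
    ++ (x ∷ xs) ys f = trans (∙-congˡ (++ xs ys f)) (sym (assoc (f x) _ _))

    if-split : ∀ (P : A → Bool) xs (f g : A → R) →
               ⨁ xs (λ x → if P x then f x else g x) ≈ ⨁ (filterᵇ P xs) f ∙ ⨁ (filterᵇ (not ∘ P) xs) g
    if-split P []       f g = sym (identityˡ ε)
    if-split P (x ∷ xs) f g with P x
    ... | true  = trans (∙-congˡ (if-split P xs f g)) (sym (assoc (f x) _ _))
    ... | false = trans (∙-congˡ (if-split P xs f g)) (x∙yz≈y∙xz (g x) _ _)

  module _ {A B : Set} where

    map : ∀ (h : A → B) xs (f : B → R) → ⨁ (L.map h xs) f ≈ ⨁ xs (f ∘ h)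
    map h xs f = reflexive (≡.cong (foldr _∙_ ε) (≡.sym (L.map-∘ xs)))

    concatMap : ∀ (g : A → List B) xs (f : B → R) → ⨁ (L.concatMap g xs) f ≈ ⨁ xs (λ x → ⨁ (g x) f)
    concatMap g []       f = refl
    concatMap g (x ∷ xs) f = trans (++ (g x) _ f) (∙-congˡ (concatMap g xs f))

    comm : ∀ xs ys (h : A → B → R) → ⨁ xs (λ x → ⨁ ys (h x)) ≈ ⨁ ys (λ y → ⨁ xs (λ x → h x y))
    comm []       ys h = sym (constant-ε ys)
    comm (x ∷ xs) ys h = trans (∙-congˡ (comm xs ys h)) (sym (distrib ys (h x) _))

  allFin-suc : ∀ {n} (f : Fin (ℕ.suc n) → R) → ⨁ (allFin (ℕ.suc n)) f ≈ f zero ∙ ⨁ (allFin n) (f ∘ suc)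
  allFin-suc {n} f = ∙-congˡ (reflexive (≡.cong (foldr _∙_ ε)
    (≡.trans (L.map-tabulate suc f) (≡.sym (L.map-tabulate id (f ∘ suc))))))

  allFin≈sum : ∀ {n} (f : Fin n → R) → ⨁ (allFin n) f ≈ Vector.sum f
  allFin≈sum {ℕ.zero}  f = refl
  allFin≈sum {ℕ.suc n} f = trans (allFin-suc f) (∙-congˡ (allFin≈sum (f ∘ suc)))

  permute : ∀ {n} (f : Fin n → R) (π : Permutation n n) → ⨁ (allFin n) f ≈ ⨁ (allFin n) (λ i → f (π ⟨$⟩ʳ i))
  permute {n} f π = begin
    ⨁ (allFin n) f                    ≈⟨ allFin≈sum f ⟩
    Vector.sum f                      ≈⟨ Vector.sum-permute f π ⟩
    Vector.sum (λ i → f (π ⟨$⟩ʳ i))   ≈⟨ allFin≈sum (λ i → f (π ⟨$⟩ʳ i)) ⟨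
    ⨁ (allFin n) (λ i → f (π ⟨$⟩ʳ i)) ∎

-- Opened only now: inside BigOperator these names belong to the monoid's setoid and to the lemmas.
open ≡ using (_≡_; _≗_; refl; sym; trans; cong; cong₂; subst; subst₂; module ≡-Reasoning)

-- Nonnegative rationals

fromℕ : ℕ → ℚ
fromℕ zero    = 0ℚ
fromℕ (suc n) = 1ℚ + fromℕ n

module _ {p q : ℚ} where

  *-monoˡ-≤ : ∀ {r} → 0ℚ ≤ℚ r → p ≤ℚ q → r * p ≤ℚ r * q
  *-monoˡ-≤ {r} r≥0 = ℚ.*-monoˡ-≤-nonNeg r {{nonNegative r≥0}}

  *-monoʳ-≤ : ∀ {r} → 0ℚ ≤ℚ r → p ≤ℚ q → p * r ≤ℚ q * r
  *-monoʳ-≤ {r} r≥0 = ℚ.*-monoʳ-≤-nonNeg r {{nonNegative r≥0}}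

  *-cancelˡ-≤ : ∀ {r} → 0ℚ < r → r * p ≤ℚ r * q → p ≤ℚ q
  *-cancelˡ-≤ {r} r>0 = ℚ.*-cancelˡ-≤-pos r {{positive r>0}}

  +-cancelʳ-≤ : ∀ r → p + r ≤ℚ q + r → p ≤ℚ q
  +-cancelʳ-≤ r p+r≤q+r = subst₂ _≤ℚ_ (cancel p) (cancel q) (ℚ.+-monoˡ-≤ (- r) p+r≤q+r)
    where
    cancel : ∀ x → x + r + - r ≡ x
    cancel x = solve 2 (λ x r → x :+ r :+ :- r := x) refl x r

  p≤p+q : 0ℚ ≤ℚ q → p ≤ℚ p + q
  p≤p+q q≥0 = subst (_≤ℚ p + q) (ℚ.+-identityʳ p) (ℚ.+-monoʳ-≤ p q≥0)

*-mono-≤ : ∀ {p q r s} → 0ℚ ≤ℚ p → 0ℚ ≤ℚ r → p ≤ℚ q → r ≤ℚ s → p * r ≤ℚ q * s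
*-mono-≤ p≥0 r≥0 p≤q r≤s = ℚ.≤-trans (*-monoʳ-≤ r≥0 p≤q) (*-monoˡ-≤ (ℚ.≤-trans p≥0 p≤q) r≤s)

*-nonNeg : ∀ {p q} → 0ℚ ≤ℚ p → 0ℚ ≤ℚ q → 0ℚ ≤ℚ p * q
*-nonNeg {p} {q} p≥0 q≥0 = subst (_≤ℚ p * q) (ℚ.*-zeroˡ q) (*-monoʳ-≤ q≥0 p≥0)

+-nonNeg : ∀ {p q} → 0ℚ ≤ℚ p → 0ℚ ≤ℚ q → 0ℚ ≤ℚ p + q
+-nonNeg = ℚ.+-mono-≤

square-nonNeg : ∀ p → 0ℚ ≤ℚ p * p
square-nonNeg p with ℚ.≤-total 0ℚ p
... | inj₁ p≥0 = *-nonNeg p≥0 p≥0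
... | inj₂ p≤0 = subst (0ℚ ≤ℚ_) (solve 1 (λ p → :- p :* :- p := p :* p) refl p)
                   (*-nonNeg (ℚ.neg-antimono-≤ p≤0) (ℚ.neg-antimono-≤ p≤0))

0≤1 : 0ℚ ≤ℚ 1ℚ
0≤1 = ℚ.≤ᵇ⇒≤ tt

fromℕ-nonNeg : ∀ n → 0ℚ ≤ℚ fromℕ n
fromℕ-nonNeg zero    = ℚ.≤-refl
fromℕ-nonNeg (suc n) = +-nonNeg 0≤1 (fromℕ-nonNeg n)

fromℕ-pos : ∀ n → 0ℚ < fromℕ (suc n)
fromℕ-pos n = ℚ.<-≤-trans (ℚ.positive⁻¹ 1ℚ) (p≤p+q (fromℕ-nonNeg n))

^-nonNeg : ∀ {p} n → 0ℚ ≤ℚ p → 0ℚ ≤ℚ p ^ℚ n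
^-nonNeg zero    p≥0 = 0≤1
^-nonNeg (suc n) p≥0 = *-nonNeg p≥0 (^-nonNeg n p≥0)

^-pos : ∀ {p} n → 0ℚ < p → 0ℚ < p ^ℚ n
^-pos zero    p>0 = ℚ.positive⁻¹ 1ℚ
^-pos {p} (suc n) p>0 = subst (_< p * p ^ℚ n) (ℚ.*-zeroˡ (p ^ℚ n))
  (ℚ.*-monoˡ-<-pos (p ^ℚ n) {{positive (^-pos n p>0)}} p>0)

^-mono-≤ : ∀ {p q} n → 0ℚ ≤ℚ p → p ≤ℚ q → p ^ℚ n ≤ℚ q ^ℚ n
^-mono-≤ zero    p≥0 p≤q = ℚ.≤-refl
^-mono-≤ (suc n) p≥0 p≤q = *-mono-≤ p≥0 (^-nonNeg n p≥0) p≤q (^-mono-≤ n p≥0 p≤q)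

^-mono-< : ∀ {p q} n → 0ℚ ≤ℚ p → p < q → p ^ℚ suc n < q ^ℚ suc n
^-mono-< {p} {q} n p≥0 p<q = ℚ.≤-<-trans (*-monoˡ-≤ p≥0 (^-mono-≤ n p≥0 (ℚ.<⇒≤ p<q)))
  (ℚ.*-monoˡ-<-pos (q ^ℚ n) {{positive (^-pos n (ℚ.≤-<-trans p≥0 p<q))}} p<q)

^-cancel-≤ : ∀ {p q} n → 0ℚ ≤ℚ q → p ^ℚ suc n ≤ℚ q ^ℚ suc n → p ≤ℚ q
^-cancel-≤ {p} {q} n q≥0 pⁿ≤qⁿ with p ≤? q
... | yes p≤q = p≤q
... | no  p≰q = ⊥-elim (ℚ.<-irrefl refl (ℚ.<-≤-trans (^-mono-< n q≥0 (ℚ.≰⇒> p≰q)) pⁿ≤qⁿ))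

^-distribʳ-* : ∀ p q n → (p * q) ^ℚ n ≡ p ^ℚ n * q ^ℚ n
^-distribʳ-* p q zero    = refl
^-distribʳ-* p q (suc n) = trans (cong (p * q *_) (^-distribʳ-* p q n))
  (solve 4 (λ p q x y → p :* q :* (x :* y) := p :* x :* (q :* y)) refl p q (p ^ℚ n) (q ^ℚ n))

1^n≡1 : ∀ n → 1ℚ ^ℚ n ≡ 1ℚ
1^n≡1 zero    = refl
1^n≡1 (suc n) = trans (cong (1ℚ *_) (1^n≡1 n)) (ℚ.*-identityˡ 1ℚ)

nⁿ-pos : ∀ n → 0ℚ < fromℕ n ^ℚ n
nⁿ-pos zero    = ℚ.positive⁻¹ 1ℚ
nⁿ-pos (suc n) = ^-pos (suc n) (fromℕ-pos n)

-- Sums and products of rationals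

module ∑ = BigOperator ℚ.+-0-commutativeMonoid
module ∏ = BigOperator ℚ.*-1-commutativeMonoid

∑ ∏ : {A : Set} → List A → (A → ℚ) → ℚ
∑ = ∑.⨁
∏ = ∏.⨁

infix 5 ∑ ∏
syntax ∑ xs (λ x → e) = ∑[ x ← xs ] e
syntax ∏ xs (λ x → e) = ∏[ x ← xs ] e

module _ {A : Set} where

  ∑-nonNeg : ∀ xs {f : A → ℚ} → (∀ x → 0ℚ ≤ℚ f x) → 0ℚ ≤ℚ ∑ xs f
  ∑-nonNeg []       f≥0 = ℚ.≤-refl
  ∑-nonNeg (x ∷ xs) f≥0 = +-nonNeg (f≥0 x) (∑-nonNeg xs f≥0)

  ∏-nonNeg : ∀ xs {f : A → ℚ} → (∀ x → 0ℚ ≤ℚ f x) → 0ℚ ≤ℚ ∏ xs f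
  ∏-nonNeg []       f≥0 = 0≤1
  ∏-nonNeg (x ∷ xs) f≥0 = *-nonNeg (f≥0 x) (∏-nonNeg xs f≥0)

  ∑-mono-≤ : ∀ xs {f g : A → ℚ} → (∀ x → f x ≤ℚ g x) → ∑ xs f ≤ℚ ∑ xs g
  ∑-mono-≤ []       f≤g = ℚ.≤-refl
  ∑-mono-≤ (x ∷ xs) f≤g = ℚ.+-mono-≤ (f≤g x) (∑-mono-≤ xs f≤g)

  ∏-mono-≤ : ∀ xs {f g : A → ℚ} → (∀ x → 0ℚ ≤ℚ f x) → (∀ x → f x ≤ℚ g x) → ∏ xs f ≤ℚ ∏ xs g
  ∏-mono-≤ []       f≥0 f≤g = ℚ.≤-refl
  ∏-mono-≤ (x ∷ xs) f≥0 f≤g = *-mono-≤ (f≥0 x) (∏-nonNeg xs f≥0) (f≤g x) (∏-mono-≤ xs f≥0 f≤g)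

  *-distribˡ-∑ : ∀ c xs (f : A → ℚ) → c * ∑ xs f ≡ ∑[ x ← xs ] c * f x
  *-distribˡ-∑ c []       f = ℚ.*-zeroʳ c
  *-distribˡ-∑ c (x ∷ xs) f = trans (ℚ.*-distribˡ-+ c (f x) (∑ xs f)) (cong (c * f x +_) (*-distribˡ-∑ c xs f))

  *-distribʳ-∑ : ∀ c xs (f : A → ℚ) → ∑ xs f * c ≡ ∑[ x ← xs ] f x * c
  *-distribʳ-∑ c xs f = trans (ℚ.*-comm (∑ xs f) c)
    (trans (*-distribˡ-∑ c xs f) (∑.cong xs (λ x → ℚ.*-comm c (f x))))

  ^-distrib-∏ : ∀ xs (f : A → ℚ) n → (∏ xs f) ^ℚ n ≡ ∏[ x ← xs ] f x ^ℚ n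
  ^-distrib-∏ []       f n = 1^n≡1 n
  ^-distrib-∏ (x ∷ xs) f n = trans (^-distribʳ-* (f x) (∏ xs f) n) (cong (f x ^ℚ n *_) (^-distrib-∏ xs f n))

∑-const : ∀ n c → ∑[ _ ← allFin n ] c ≡ fromℕ n * c
∑-const zero    c = sym (ℚ.*-zeroˡ c)
∑-const (suc n) c = trans (∑.allFin-suc {n} (λ _ → c)) (trans (cong (c +_) (∑-const n c))
  (solve 2 (λ c m → c :+ m :* c := (con 1ℚ :+ m) :* c) refl c (fromℕ n)))

∏-const : ∀ n c → ∏[ _ ← allFin n ] c ≡ c ^ℚ n
∏-const zero    c = refl
∏-const (suc n) c = trans (∏.allFin-suc {n} (λ _ → c)) (cong (c *_) (∏-const n c))

∏-lookup : ∀ {X : Set} (l : List X) (g : X → ℚ) → ∏ l g ≡ ∏[ i ← allFin (length l) ] g (L.lookup l i)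
∏-lookup l g = trans (cong (λ l′ → ∏ l′ g) (sym (L.tabulate-lookup l)))
  (trans (cong (λ l′ → ∏ l′ g) (sym (L.map-tabulate id (L.lookup l)))) (∏.map (L.lookup l) (allFin (length l)) g))

∏-idem : ∀ {A : Set} xs (f : A → ℚ) → (∀ x → f x * f x ≡ f x) → ∏ xs f * ∏ xs f ≡ ∏ xs f
∏-idem xs f idem = trans (sym (∏.distrib xs f f)) (∏.cong xs idem)

-- AM-GM

-- Young's inequality for the exponents N + 1 and (N + 1)/N, cleared of denominators.
-- The gap rhs N − lhs N satisfies  gap (N + 1) = c · gap N + (N + 1) · a ^ N · (c − a)².
young : ∀ N {c a} → 0ℚ ≤ℚ c → 0ℚ ≤ℚ a →
        fromℕ (suc N) * c * a ^ℚ N ≤ℚ c ^ℚ suc N + fromℕ N * a ^ℚ suc N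
young zero {c} {a} _ _ = ℚ.≤-reflexive
  (solve 2 (λ c a → (con 1ℚ :+ con 0ℚ) :* c :* con 1ℚ := c :* con 1ℚ :+ con 0ℚ :* (a :* con 1ℚ)) refl c a)
young (suc N) {c} {a} c≥0 a≥0 = +-cancelʳ-≤ (c * rhs N) (begin
  lhs (suc N) + c * rhs N      ≤⟨ p≤p+q gap ⟩
  lhs (suc N) + c * rhs N + δ  ≡⟨ balance ⟩
  rhs (suc N) + c * lhs N      ≤⟨ ℚ.+-monoʳ-≤ (rhs (suc N)) (*-monoˡ-≤ c≥0 (young N c≥0 a≥0)) ⟩
  rhs (suc N) + c * rhs N      ∎)
  where
  open ℚ.≤-Reasoning
  lhs rhs : ℕ → ℚ
  lhs k = fromℕ (suc k) * c * a ^ℚ k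
  rhs k = c ^ℚ suc k + fromℕ k * a ^ℚ suc k
  δ = fromℕ (suc N) * a ^ℚ N * ((c - a) * (c - a))
  gap : 0ℚ ≤ℚ δ
  gap = *-nonNeg (*-nonNeg (fromℕ-nonNeg (suc N)) (^-nonNeg N a≥0)) (square-nonNeg (c - a))
  balance : lhs (suc N) + c * rhs N + δ ≡ rhs (suc N) + c * lhs N
  balance = solve 5 (λ n c a A C →
      (con 1ℚ :+ (con 1ℚ :+ n)) :* c :* (a :* A) :+ c :* (c :* C :+ n :* (a :* A))
        :+ (con 1ℚ :+ n) :* A :* ((c :- a) :* (c :- a))
    := c :* (c :* C) :+ (con 1ℚ :+ n) :* (a :* (a :* A)) :+ c :* ((con 1ℚ :+ n) :* c :* A))
    refl (fromℕ N) c a (a ^ℚ N) (c ^ℚ N)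

-- Young's inequality at c = D (x + s), a = (D + 1) s, divided by D.
amgm-step : ∀ D {x s} → 0ℚ ≤ℚ x → 0ℚ ≤ℚ s →
            fromℕ (suc D) ^ℚ suc D * x * s ^ℚ D ≤ℚ fromℕ D ^ℚ D * (x + s) ^ℚ suc D
amgm-step zero {x} {s} _ s≥0 = subst₂ _≤ℚ_
  (solve 1 (λ x → x := (con 1ℚ :+ con 0ℚ) :* con 1ℚ :* x :* con 1ℚ) refl x)
  (solve 2 (λ x s → x :+ s := con 1ℚ :* ((x :+ s) :* con 1ℚ)) refl x s)
  (p≤p+q s≥0)
amgm-step (suc D′) {x} {s} x≥0 s≥0 = *-cancelˡ-≤ (fromℕ-pos D′) (+-cancelʳ-≤ κ (begin
  d * (e ^ℚ suc D * x * s ^ℚ D) + κ    ≡⟨ lhs ⟩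
  e * c * a ^ℚ D                       ≤⟨ young D c≥0 a≥0 ⟩
  c ^ℚ suc D + d * a ^ℚ suc D          ≡⟨ rhs ⟩
  d * (d ^ℚ D * (x + s) ^ℚ suc D) + κ  ∎))
  where
  open ℚ.≤-Reasoning
  D = suc D′
  d = fromℕ D
  e = fromℕ (suc D)
  c = d * (x + s)
  a = e * s
  κ = d * (e ^ℚ suc D * s ^ℚ suc D)
  c≥0 : 0ℚ ≤ℚ c
  c≥0 = *-nonNeg (fromℕ-nonNeg D) (+-nonNeg x≥0 s≥0)
  a≥0 : 0ℚ ≤ℚ a
  a≥0 = *-nonNeg (fromℕ-nonNeg (suc D)) s≥0
  lhs : d * (e ^ℚ suc D * x * s ^ℚ D) + κ ≡ e * c * a ^ℚ D
  lhs = trans (solve 6 (λ d e x s E S → d :* (e :* E :* x :* S) :+ d :* (e :* E :* (s :* S))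
                                      := e :* (d :* (x :+ s)) :* (E :* S))
                 refl d e x s (e ^ℚ D) (s ^ℚ D))
              (cong (e * c *_) (sym (^-distribʳ-* e s D)))
  rhs : c ^ℚ suc D + d * a ^ℚ suc D ≡ d * (d ^ℚ D * (x + s) ^ℚ suc D) + κ
  rhs = trans (cong₂ (λ u v → u + d * v) (^-distribʳ-* d (x + s) (suc D)) (^-distribʳ-* e s (suc D)))
              (solve 4 (λ d P U V → d :* P :* U :+ d :* V := d :* (P :* U) :+ d :* V)
                 refl d (d ^ℚ D) ((x + s) ^ℚ suc D) (e ^ℚ suc D * s ^ℚ suc D))

amgm : ∀ n (a : Fin n → ℚ) → (∀ i → 0ℚ ≤ℚ a i) →
       fromℕ n ^ℚ n * (∏[ i ← allFin n ] a i) ≤ℚ (∑[ i ← allFin n ] a i) ^ℚ n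
amgm zero    a a≥0 = ℚ.≤-refl
amgm (suc D) a a≥0 = subst₂ (λ u v → fromℕ (suc D) ^ℚ suc D * u ≤ℚ v ^ℚ suc D)
  (sym (∏.allFin-suc a)) (sym (∑.allFin-suc a))
  (*-cancelˡ-≤ (nⁿ-pos D) (begin
    fromℕ D ^ℚ D * (E * (x * P))
      ≡⟨ solve 4 (λ C E x P → C :* (E :* (x :* P)) := E :* x :* (C :* P)) refl (fromℕ D ^ℚ D) E x P ⟩
    E * x * (fromℕ D ^ℚ D * P)
      ≤⟨ *-monoˡ-≤ (*-nonNeg (^-nonNeg (suc D) (fromℕ-nonNeg (suc D))) (a≥0 zero)) (amgm D (a ∘ suc) (a≥0 ∘ suc)) ⟩
    E * x * s ^ℚ D
      ≤⟨ amgm-step D (a≥0 zero) (∑-nonNeg (allFin D) (a≥0 ∘ suc)) ⟩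
    fromℕ D ^ℚ D * (x + s) ^ℚ suc D
      ∎))
  where
  open ℚ.≤-Reasoning
  E = fromℕ (suc D) ^ℚ suc D
  x = a zero
  s = ∑[ i ← allFin D ] a (suc i)
  P = ∏[ i ← allFin D ] a (suc i)

amgm-bound : ∀ D (a : Fin (suc D) → ℚ) {v} → (∀ i → 0ℚ ≤ℚ a i) → 0ℚ ≤ℚ v →
             v ^ℚ suc D ≤ℚ ∏[ i ← allFin (suc D) ] a i → fromℕ (suc D) * v ≤ℚ ∑[ i ← allFin (suc D) ] a i
amgm-bound D a {v} a≥0 v≥0 vⁿ≤∏a = ^-cancel-≤ D (∑-nonNeg (allFin (suc D)) a≥0) (begin
  (fromℕ (suc D) * v) ^ℚ suc D                           ≡⟨ ^-distribʳ-* (fromℕ (suc D)) v (suc D) ⟩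
  fromℕ (suc D) ^ℚ suc D * v ^ℚ suc D                    ≤⟨ *-monoˡ-≤ (^-nonNeg (suc D) (fromℕ-nonNeg (suc D))) vⁿ≤∏a ⟩
  fromℕ (suc D) ^ℚ suc D * (∏[ i ← allFin (suc D) ] a i) ≤⟨ amgm (suc D) a a≥0 ⟩
  (∑[ i ← allFin (suc D) ] a i) ^ℚ suc D                 ∎)
  where open ℚ.≤-Reasoning

-- Sums over maps Fin k → A

-- Hypotheses of this kind replace function extensionality: allMaps builds its maps with a
-- pattern-matching lambda, which agrees with cons y β only pointwise.
Extensional : {A : Set} {k : ℕ} → ((Fin k → A) → ℚ) → Set
Extensional h = ∀ {β β′} → β ≗ β′ → h β ≡ h β′

DependsOnly : {A : Set} {k : ℕ} → (Fin k → Bool) → ((Fin k → A) → ℚ) → Set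
DependsOnly s h = ∀ {β β′} → (∀ j → s j ≡ true → β j ≡ β′ j) → h β ≡ h β′

module _ {A : Set} where

  cons-cong : ∀ {k} (y : A) {β β′ : Fin k → A} → β ≗ β′ → cons y β ≗ cons y β′
  cons-cong y β≗β′ zero    = refl
  cons-cong y β≗β′ (suc i) = β≗β′ i

  ∑-allMaps-suc : ∀ (Y : List A) k (h : (Fin (suc k) → A) → ℚ) → Extensional h →
                  ∑ (allMaps Y (suc k)) h ≡ ∑[ y ← Y ] ∑[ β ← allMaps Y k ] h (cons y β)
  ∑-allMaps-suc Y k h h-ext = trans (∑.concatMap _ Y h) (∑.cong Y λ y →
    trans (∑.map _ (allMaps Y k) h) (∑.cong (allMaps Y k) λ β → h-ext λ { zero → refl ; (suc i) → refl }))

  ∏∑≡∑∏ : ∀ (Y : List A) k (F : Fin k → A → ℚ) →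
          ∏[ i ← allFin k ] ∑ Y (F i) ≡ ∑[ β ← allMaps Y k ] ∏[ i ← allFin k ] F i (β i)
  ∏∑≡∑∏ Y zero    F = refl
  ∏∑≡∑∏ Y (suc k) F = begin
    ∏[ i ← allFin (suc k) ] ∑ Y (F i)
      ≡⟨ ∏.allFin-suc (λ i → ∑ Y (F i)) ⟩
    ∑ Y (F zero) * (∏[ i ← allFin k ] ∑ Y (F (suc i)))
      ≡⟨ cong (∑ Y (F zero) *_) (∏∑≡∑∏ Y k (F ∘ suc)) ⟩
    ∑ Y (F zero) * (∑[ β ← allMaps Y k ] ∏[ i ← allFin k ] F (suc i) (β i))
      ≡⟨ *-distribʳ-∑ _ Y (F zero) ⟩
    ∑[ y ← Y ] F zero y * (∑[ β ← allMaps Y k ] ∏[ i ← allFin k ] F (suc i) (β i))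
      ≡⟨ ∑.cong Y (λ y → *-distribˡ-∑ (F zero y) (allMaps Y k) _) ⟩
    ∑[ y ← Y ] ∑[ β ← allMaps Y k ] F zero y * (∏[ i ← allFin k ] F (suc i) (β i))
      ≡⟨ trans (∑-allMaps-suc Y k _ λ β≗β′ → ∏.cong (allFin (suc k)) λ i → cong (F i) (β≗β′ i))
               (∑.cong Y λ y → ∑.cong (allMaps Y k) λ β → ∏.allFin-suc (λ i → F i (cons y β i))) ⟨
    ∑[ β ← allMaps Y (suc k) ] ∏[ i ← allFin (suc k) ] F i (β i)
      ∎
    where open ≡-Reasoning

  ∑-filterᵇ : ∀ (P : A → Bool) xs (f : A → ℚ) → ∑ (filterᵇ P xs) f ≡ ∑[ x ← xs ] ind (P x) * f x
  ∑-filterᵇ P []       f = refl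
  ∑-filterᵇ P (x ∷ xs) f with P x
  ... | true  = cong₂ _+_ (sym (ℚ.*-identityˡ (f x))) (∑-filterᵇ P xs f)
  ... | false = trans (∑-filterᵇ P xs f) (trans (sym (ℚ.+-identityˡ _)) (cong (_+ _) (sym (ℚ.*-zeroˡ (f x)))))

  ∑-allMaps-filterᵇ : ∀ (P : A → Bool) (Y : List A) k (h : (Fin k → A) → ℚ) → Extensional h →
    ∑ (allMaps (filterᵇ P Y) k) h ≡ ∑[ β ← allMaps Y k ] (∏[ i ← allFin k ] ind (P (β i))) * h β
  ∑-allMaps-filterᵇ P Y zero    h h-ext = cong (_+ 0ℚ) (trans (h-ext λ ()) (sym (ℚ.*-identityˡ _)))
  ∑-allMaps-filterᵇ P Y (suc k) h h-ext = begin
    ∑ (allMaps (filterᵇ P Y) (suc k)) h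
      ≡⟨ ∑-allMaps-suc (filterᵇ P Y) k h h-ext ⟩
    ∑[ y ← filterᵇ P Y ] ∑[ β ← allMaps (filterᵇ P Y) k ] h (cons y β)
      ≡⟨ ∑.cong (filterᵇ P Y) (λ y → ∑-allMaps-filterᵇ P Y k _ (h-ext ∘ cons-cong y)) ⟩
    ∑[ y ← filterᵇ P Y ] ∑[ β ← allMaps Y k ] (∏[ i ← allFin k ] χ (β i)) * h (cons y β)
      ≡⟨ ∑-filterᵇ P Y _ ⟩
    ∑[ y ← Y ] χ y * (∑[ β ← allMaps Y k ] (∏[ i ← allFin k ] χ (β i)) * h (cons y β))
      ≡⟨ ∑.cong Y (λ y → trans (*-distribˡ-∑ (χ y) (allMaps Y k) _) (∑.cong (allMaps Y k) λ β →
           sym (ℚ.*-assoc (χ y) (∏[ i ← allFin k ] χ (β i)) (h (cons y β))))) ⟩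
    ∑[ y ← Y ] ∑[ β ← allMaps Y k ] χ y * (∏[ i ← allFin k ] χ (β i)) * h (cons y β)
      ≡⟨ trans (∑-allMaps-suc Y k _ (λ β≗β′ → cong₂ _*_ (∏.cong (allFin (suc k)) λ i → cong χ (β≗β′ i)) (h-ext β≗β′)))
               (∑.cong Y λ y → ∑.cong (allMaps Y k) λ β → cong (_* h (cons y β)) (∏.allFin-suc (λ i → χ (cons y β i)))) ⟨
    ∑[ β ← allMaps Y (suc k) ] (∏[ i ← allFin (suc k) ] χ (β i)) * h β
      ∎
    where
    open ≡-Reasoning
    χ : A → ℚ
    χ = ind ∘ P

module _ {A B : Set} where

  ∑-cartesianProduct : ∀ (xs : List A) (ys : List B) (f : A × B → ℚ) →
                       ∑ (L.cartesianProduct xs ys) f ≡ ∑[ x ← xs ] ∑[ y ← ys ] f (x , y)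
  ∑-cartesianProduct []       ys f = refl
  ∑-cartesianProduct (x ∷ xs) ys f =
    trans (∑.++ (L.map (x ,_) ys) _ f) (cong₂ _+_ (∑.map (x ,_) ys f) (∑-cartesianProduct xs ys f))

  ∑-allMaps-cartesianProduct : ∀ (Xs : List A) (Ys : List B) k (h : (Fin k → A × B) → ℚ) → Extensional h →
    ∑ (allMaps (L.cartesianProduct Xs Ys) k) h ≡ ∑[ α ← allMaps Xs k ] ∑[ β ← allMaps Ys k ] h < α , β >
  ∑-allMaps-cartesianProduct Xs Ys zero    h h-ext = cong (_+ 0ℚ) (trans (h-ext λ ()) (sym (ℚ.+-identityʳ _)))
  ∑-allMaps-cartesianProduct Xs Ys (suc k) h h-ext = begin
    ∑ (allMaps (L.cartesianProduct Xs Ys) (suc k)) h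
      ≡⟨ ∑-allMaps-suc (L.cartesianProduct Xs Ys) k h h-ext ⟩
    ∑[ xy ← L.cartesianProduct Xs Ys ] ∑[ φ ← allMaps (L.cartesianProduct Xs Ys) k ] h (cons xy φ)
      ≡⟨ ∑-cartesianProduct Xs Ys _ ⟩
    ∑[ x ← Xs ] ∑[ y ← Ys ] ∑[ φ ← allMaps (L.cartesianProduct Xs Ys) k ] h (cons (x , y) φ)
      ≡⟨ ∑.cong Xs (λ x → ∑.cong Ys λ y → ∑-allMaps-cartesianProduct Xs Ys k _ (h-ext ∘ cons-cong (x , y))) ⟩
    ∑[ x ← Xs ] ∑[ y ← Ys ] ∑[ α ← allMaps Xs k ] ∑[ β ← allMaps Ys k ] h (cons (x , y) < α , β >)
      ≡⟨ ∑.cong Xs (λ x → ∑.comm Ys (allMaps Xs k) _) ⟩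
    ∑[ x ← Xs ] ∑[ α ← allMaps Xs k ] ∑[ y ← Ys ] ∑[ β ← allMaps Ys k ] h (cons (x , y) < α , β >)
      ≡⟨ ∑.cong Xs (λ x → ∑.cong (allMaps Xs k) λ α → ∑.cong Ys λ y → ∑.cong (allMaps Ys k) λ β → h-ext λ
           { zero → refl ; (suc i) → refl }) ⟩
    ∑[ x ← Xs ] ∑[ α ← allMaps Xs k ] ∑[ y ← Ys ] ∑[ β ← allMaps Ys k ] h < cons x α , cons y β >
      ≡⟨ ∑.cong Xs (λ x → ∑.cong (allMaps Xs k) λ α →
           ∑-allMaps-suc Ys k _ (λ β≗β′ → h-ext λ i → cong (cons x α i ,_) (β≗β′ i))) ⟨
    ∑[ x ← Xs ] ∑[ α ← allMaps Xs k ] ∑[ β ← allMaps Ys (suc k) ] h < cons x α , β >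
      ≡⟨ ∑-allMaps-suc Xs k _ (λ α≗α′ → ∑.cong (allMaps Ys (suc k)) λ β → h-ext λ i → cong (_, β i) (α≗α′ i)) ⟨
    ∑[ α ← allMaps Xs (suc k) ] ∑[ β ← allMaps Ys (suc k) ] h < α , β >
      ∎
    where open ≡-Reasoning

module _ {A : Set} (Y : List A) where

  ∑-^ : ∀ (f : A → ℚ) n → (∑ Y f) ^ℚ n ≡ ∑[ t ← allMaps Y n ] ∏[ i ← allFin n ] f (t i)
  ∑-^ f n = trans (sym (∏-const n (∑ Y f))) (∏∑≡∑∏ Y n (λ _ → f))

  ∑∏-permute : ∀ {n} (π : Permutation n n) (F : Fin n → A → ℚ) →
               ∑[ t ← allMaps Y n ] ∏[ i ← allFin n ] F i (t (π ⟨$⟩ʳ i)) ≡ ∏[ i ← allFin n ] ∑ Y (F i)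
  ∑∏-permute {n} π F = begin
    ∑[ t ← allMaps Y n ] ∏[ i ← allFin n ] F i (t (π ⟨$⟩ʳ i))
      ≡⟨ ∑.cong (allMaps Y n) (λ t → ∏.cong (allFin n) λ i → cong (λ j → F j (t (π ⟨$⟩ʳ i))) (sym (inverseˡ π))) ⟩
    ∑[ t ← allMaps Y n ] ∏[ i ← allFin n ] F (π ⟨$⟩ˡ (π ⟨$⟩ʳ i)) (t (π ⟨$⟩ʳ i))
      ≡⟨ ∑.cong (allMaps Y n) (λ t → ∏.permute (λ j → F (π ⟨$⟩ˡ j) (t j)) π) ⟨
    ∑[ t ← allMaps Y n ] ∏[ j ← allFin n ] F (π ⟨$⟩ˡ j) (t j)
      ≡⟨ ∏∑≡∑∏ Y n (λ j → F (π ⟨$⟩ˡ j)) ⟨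
    ∏[ j ← allFin n ] ∑ Y (F (π ⟨$⟩ˡ j))
      ≡⟨ ∏.permute (λ i → ∑ Y (F i)) (flip π) ⟨
    ∏[ i ← allFin n ] ∑ Y (F i)
      ∎
    where open ≡-Reasoning

-- Hölder

module CyclicShift (D : ℕ) where

  infixl 6 _⊕_
  _⊕_ : Fin (suc D) → ℕ → Fin (suc D)
  i ⊕ a = (toℕ i ℕ.+ a) mod suc D

  toℕ-⊕ : ∀ i a → toℕ (i ⊕ a) ≡ (toℕ i ℕ.+ a) % suc D
  toℕ-⊕ i a = Fin.toℕ-fromℕ< _

  ⊕-assoc : ∀ i a b → i ⊕ a ⊕ b ≡ i ⊕ (a ℕ.+ b)
  ⊕-assoc i a b = Fin.toℕ-injective (begin
    toℕ (i ⊕ a ⊕ b)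
      ≡⟨ toℕ-⊕ (i ⊕ a) b ⟩
    (toℕ (i ⊕ a) ℕ.+ b) % suc D
      ≡⟨ cong (λ x → (x ℕ.+ b) % suc D) (toℕ-⊕ i a) ⟩
    ((toℕ i ℕ.+ a) % suc D ℕ.+ b) % suc D
      ≡⟨ %-distribˡ-+ ((toℕ i ℕ.+ a) % suc D) b (suc D) ⟩
    ((toℕ i ℕ.+ a) % suc D % suc D ℕ.+ b % suc D) % suc D
      ≡⟨ cong (λ x → (x ℕ.+ b % suc D) % suc D) (m%n%n≡m%n (toℕ i ℕ.+ a) (suc D)) ⟩
    ((toℕ i ℕ.+ a) % suc D ℕ.+ b % suc D) % suc D
      ≡⟨ %-distribˡ-+ (toℕ i ℕ.+ a) b (suc D) ⟨
    (toℕ i ℕ.+ a ℕ.+ b) % suc D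
      ≡⟨ cong (_% suc D) (ℕ.+-assoc (toℕ i) a b) ⟩
    (toℕ i ℕ.+ (a ℕ.+ b)) % suc D
      ≡⟨ toℕ-⊕ i (a ℕ.+ b) ⟨
    toℕ (i ⊕ (a ℕ.+ b))
      ∎)
    where open ≡-Reasoning

  ⊕-period : ∀ i → i ⊕ suc D ≡ i
  ⊕-period i = Fin.toℕ-injective (trans (toℕ-⊕ i (suc D))
    (trans ([m+n]%n≡m%n (toℕ i) (suc D)) (m<n⇒m%n≡m (Fin.toℕ<n i))))

  ⊕-comm : ∀ i k → i ⊕ toℕ k ≡ k ⊕ toℕ i
  ⊕-comm i k = cong (_mod suc D) (ℕ.+-comm (toℕ i) (toℕ k))

  rotation : Fin (suc D) → Permutation (suc D) (suc D)
  rotation k = permutation (_⊕ toℕ k) (_⊕ (suc D ℕ.∸ toℕ k))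
    (λ i → trans (⊕-assoc i _ (toℕ k)) (trans (cong (i ⊕_) (ℕ.m∸n+n≡m k≤D+1)) (⊕-period i)))
    (λ i → trans (⊕-assoc i (toℕ k) _) (trans (cong (i ⊕_) (ℕ.m+[n∸m]≡n k≤D+1)) (⊕-period i)))
    where
    k≤D+1 : toℕ k ℕ.≤ suc D
    k≤D+1 = ℕ.<⇒≤ (Fin.toℕ<n k)

module _ (D : ℕ) where
  open CyclicShift D

  ∏∏-rotate : ∀ {A : Set} (M : Fin (suc D) → A → ℚ) (t : Fin (suc D) → A) →
              ∏[ j ← allFin (suc D) ] ∏[ i ← allFin (suc D) ] M i (t j)
              ≡ ∏[ k ← allFin (suc D) ] ∏[ i ← allFin (suc D) ] M i (t (i ⊕ toℕ k))
  ∏∏-rotate M t = begin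
    ∏[ j ← allFin (suc D) ] ∏[ i ← allFin (suc D) ] M i (t j)
      ≡⟨ ∏.comm (allFin (suc D)) (allFin (suc D)) (λ j i → M i (t j)) ⟩
    ∏[ i ← allFin (suc D) ] ∏[ j ← allFin (suc D) ] M i (t j)
      ≡⟨ ∏.cong (allFin (suc D)) (λ i → ∏.permute (M i ∘ t) (rotation i)) ⟩
    ∏[ i ← allFin (suc D) ] ∏[ k ← allFin (suc D) ] M i (t (k ⊕ toℕ i))
      ≡⟨ ∏.cong (allFin (suc D)) (λ i → ∏.cong (allFin (suc D)) λ k → cong (M i ∘ t) (⊕-comm k i)) ⟩
    ∏[ i ← allFin (suc D) ] ∏[ k ← allFin (suc D) ] M i (t (i ⊕ toℕ k))
      ≡⟨ ∏.comm (allFin (suc D)) (allFin (suc D)) (λ i k → M i (t (i ⊕ toℕ k))) ⟩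
    ∏[ k ← allFin (suc D) ] ∏[ i ← allFin (suc D) ] M i (t (i ⊕ toℕ k))
      ∎
    where open ≡-Reasoning

  -- Hölder's inequality  ∑ μ f₀⋯f_D ≤ ∏ᵢ (∑ μ fᵢ^(D+1))^(1/(D+1))  in root-free form:
  -- I plays f₀⋯f_D and M i plays fᵢ^(D+1), with a common factor C carried along.
  -- Expanding the (D+1)-st power over tuples t, AM-GM bounds (D+1) ∏ⱼ I (t j) by the
  -- D+1 cyclically shifted products C ∏ᵢ M i (t (i ⊕ k)), each of which sums to the right-hand side.
  hölder : ∀ {A : Set} (Y : List A) (μ I : A → ℚ) (M : Fin (suc D) → A → ℚ) (C : ℚ) →
           (∀ y → 0ℚ ≤ℚ μ y) → (∀ y → 0ℚ ≤ℚ I y) → (∀ i y → 0ℚ ≤ℚ M i y) → 0ℚ ≤ℚ C →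
           (∀ y → I y ^ℚ suc D ≤ℚ C * (∏[ i ← allFin (suc D) ] M i y)) →
           (∑[ y ← Y ] μ y * I y) ^ℚ suc D ≤ℚ C * (∏[ i ← allFin (suc D) ] ∑[ y ← Y ] μ y * M i y)
  hölder {A} Y μ I M C μ≥0 I≥0 M≥0 C≥0 Iⁿ≤C∏M = *-cancelˡ-≤ (fromℕ-pos D) (begin
    n * (∑[ y ← Y ] μ y * I y) ^ℚ suc D
      ≡⟨ cong (n *_) (trans (∑-^ Y (λ y → μ y * I y) (suc D)) (∑.cong tuples λ t → ∏.distrib Fin₊ (μ ∘ t) (I ∘ t))) ⟩
    n * (∑[ t ← tuples ] wt t * (∏[ j ← Fin₊ ] I (t j)))
      ≡⟨ *-distribˡ-∑ n tuples _ ⟩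
    ∑[ t ← tuples ] n * (wt t * (∏[ j ← Fin₊ ] I (t j)))
      ≤⟨ ∑-mono-≤ tuples (λ t → amgm-termwise t) ⟩
    ∑[ t ← tuples ] wt t * (∑[ k ← Fin₊ ] C * shifted k t)
      ≡⟨ ∑.cong tuples (λ t → trans (*-distribˡ-∑ (wt t) Fin₊ _) (∑.cong Fin₊ λ k → x∙yz≈y∙xz (wt t) C (shifted k t))) ⟩
    ∑[ t ← tuples ] ∑[ k ← Fin₊ ] C * (wt t * shifted k t)
      ≡⟨ ∑.comm tuples Fin₊ _ ⟩
    ∑[ k ← Fin₊ ] ∑[ t ← tuples ] C * (wt t * shifted k t)
      ≡⟨ ∑.cong Fin₊ (λ k → trans (sym (*-distribˡ-∑ C tuples _)) (cong (C *_) (shifted-sum k))) ⟩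
    ∑[ k ← Fin₊ ] C * P
      ≡⟨ ∑-const (suc D) (C * P) ⟩
    n * (C * P) ∎)
    where
    open ℚ.≤-Reasoning
    open import Algebra.Properties.CommutativeSemigroup (CommutativeMonoid.commutativeSemigroup ℚ.*-1-commutativeMonoid)
      using (x∙yz≈y∙xz)
    n = fromℕ (suc D)
    Fin₊ = allFin (suc D)
    tuples = allMaps Y (suc D)
    P = ∏[ i ← Fin₊ ] ∑[ y ← Y ] μ y * M i y
    wt : (Fin (suc D) → A) → ℚ
    wt t = ∏[ j ← Fin₊ ] μ (t j)
    shifted : Fin (suc D) → (Fin (suc D) → A) → ℚ
    shifted k t = ∏[ i ← Fin₊ ] M i (t (i ⊕ toℕ k))

    shifted-sum : ∀ k → ∑[ t ← tuples ] wt t * shifted k t ≡ P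
    shifted-sum k = trans (∑.cong tuples λ t → trans (cong (_* shifted k t) (∏.permute (μ ∘ t) (rotation k)))
                                                    (sym (∏.distrib Fin₊ (μ ∘ t ∘ (_⊕ toℕ k)) _)))
                          (∑∏-permute Y (rotation k) (λ i y → μ y * M i y))

    power-bound : ∀ t → (∏[ j ← Fin₊ ] I (t j)) ^ℚ suc D ≤ℚ ∏[ k ← Fin₊ ] C * shifted k t
    power-bound t = begin
      (∏[ j ← Fin₊ ] I (t j)) ^ℚ suc D
        ≡⟨ ^-distrib-∏ Fin₊ (I ∘ t) (suc D) ⟩
      ∏[ j ← Fin₊ ] I (t j) ^ℚ suc D
        ≤⟨ ∏-mono-≤ Fin₊ (λ j → ^-nonNeg (suc D) (I≥0 (t j))) (Iⁿ≤C∏M ∘ t) ⟩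
      ∏[ j ← Fin₊ ] C * (∏[ i ← Fin₊ ] M i (t j))
        ≡⟨ ∏.distrib Fin₊ (λ _ → C) _ ⟩
      (∏[ _ ← Fin₊ ] C) * (∏[ j ← Fin₊ ] ∏[ i ← Fin₊ ] M i (t j))
        ≡⟨ cong (∏ Fin₊ (λ _ → C) *_) (∏∏-rotate M t) ⟩
      (∏[ _ ← Fin₊ ] C) * (∏[ k ← Fin₊ ] shifted k t)
        ≡⟨ ∏.distrib Fin₊ (λ _ → C) (λ k → shifted k t) ⟨
      ∏[ k ← Fin₊ ] C * shifted k t
        ∎

    amgm-termwise : ∀ t → n * (wt t * (∏[ j ← Fin₊ ] I (t j))) ≤ℚ wt t * (∑[ k ← Fin₊ ] C * shifted k t)
    amgm-termwise t = subst (_≤ℚ wt t * (∑[ k ← Fin₊ ] C * shifted k t)) (x∙yz≈y∙xz (wt t) n _)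
      (*-monoˡ-≤ (∏-nonNeg Fin₊ (μ≥0 ∘ t))
        (amgm-bound D (λ k → C * shifted k t) (λ k → *-nonNeg C≥0 (∏-nonNeg Fin₊ λ i → M≥0 i _))
          (∏-nonNeg Fin₊ (I≥0 ∘ t)) (power-bound t)))

hölderᴸ : ∀ {A X : Set} {D} (Y : List A) (μ I : A → ℚ) (l : List X) (M : X → A → ℚ) (C : ℚ) → length l ≡ suc D →
          (∀ y → 0ℚ ≤ℚ μ y) → (∀ y → 0ℚ ≤ℚ I y) → (∀ x y → 0ℚ ≤ℚ M x y) → 0ℚ ≤ℚ C →
          (∀ y → I y ^ℚ suc D ≤ℚ C * (∏[ x ← l ] M x y)) →
          (∑[ y ← Y ] μ y * I y) ^ℚ suc D ≤ℚ C * (∏[ x ← l ] ∑[ y ← Y ] μ y * M x y)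
hölderᴸ Y μ I l@(_ ∷ xs) M C refl μ≥0 I≥0 M≥0 C≥0 Iⁿ≤C∏M =
  subst (λ P → (∑[ y ← Y ] μ y * I y) ^ℚ suc (length xs) ≤ℚ C * P) (sym (∏-lookup l (λ x → ∑[ y ← Y ] μ y * M x y)))
    (hölder (length xs) Y μ I (M ∘ L.lookup l) C μ≥0 I≥0 (λ i → M≥0 _) C≥0
      (λ y → subst (λ P → I y ^ℚ suc (length xs) ≤ℚ C * P) (∏-lookup l (λ x → M x y)) (Iⁿ≤C∏M y)))

-- Boolean exponents and counting

infixr 8 _^ᵇ_
_^ᵇ_ : ℚ → Bool → ℚ
x ^ᵇ b = if b then x else 1ℚ

^ᵇ-nonNeg : ∀ {x} b → 0ℚ ≤ℚ x → 0ℚ ≤ℚ x ^ᵇ b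
^ᵇ-nonNeg true  x≥0 = x≥0
^ᵇ-nonNeg false x≥0 = 0≤1

^ᵇ-distribʳ-* : ∀ x y b → (x * y) ^ᵇ b ≡ x ^ᵇ b * y ^ᵇ b
^ᵇ-distribʳ-* x y true  = refl
^ᵇ-distribʳ-* x y false = sym (ℚ.*-identityˡ 1ℚ)

module _ {x : ℚ} (idem : x * x ≡ x) where

  ^ᵇ-idem : ∀ b → x ^ᵇ b * x ^ᵇ b ≡ x ^ᵇ b
  ^ᵇ-idem true  = idem
  ^ᵇ-idem false = ℚ.*-identityˡ 1ℚ

  ^ᵇ-∨ : ∀ b c → x ^ᵇ (b ∨ c) ≡ x ^ᵇ b * x ^ᵇ c
  ^ᵇ-∨ true  true  = sym idem
  ^ᵇ-∨ true  false = sym (ℚ.*-identityʳ x)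
  ^ᵇ-∨ false c     = sym (ℚ.*-identityˡ (x ^ᵇ c))

^ᵇ-cong : ∀ {x y} b → (b ≡ true → x ≡ y) → x ^ᵇ b ≡ y ^ᵇ b
^ᵇ-cong true  x≡y = x≡y refl
^ᵇ-cong false _   = refl

≟-suc : ∀ {n} (a v : Fin n) → ⌊ suc a ≟ suc v ⌋ ≡ ⌊ a ≟ v ⌋
≟-suc a v with a ≟ v
... | yes _ = refl
... | no  _ = refl

∏-^ᵇ-≟ : ∀ {n} (a : Fin n) (h : Fin n → ℚ) → ∏[ v ← allFin n ] h v ^ᵇ ⌊ a ≟ v ⌋ ≡ h a
∏-^ᵇ-≟ {suc n} zero    h = trans (∏.allFin-suc (λ v → h v ^ᵇ ⌊ zero ≟ v ⌋))
  (trans (cong (h zero *_) (∏.constant-ε (allFin n))) (ℚ.*-identityʳ (h zero)))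
∏-^ᵇ-≟ {suc n} (suc a) h = trans (∏.allFin-suc (λ v → h v ^ᵇ ⌊ suc a ≟ v ⌋))
  (trans (ℚ.*-identityˡ _) (trans (∏.cong (allFin n) λ v → cong (h (suc v) ^ᵇ_) (≟-suc a v)) (∏-^ᵇ-≟ a (h ∘ suc))))

ind-∧ : ∀ b c → ind (b ∧ c) ≡ ind b * ind c
ind-∧ true  c = sym (ℚ.*-identityˡ (ind c))
ind-∧ false c = sym (ℚ.*-zeroˡ (ind c))

ind-idem : ∀ b → ind b * ind b ≡ ind b
ind-idem true  = ℚ.*-identityˡ 1ℚ
ind-idem false = ℚ.*-zeroˡ 0ℚ

ind-nonNeg : ∀ b → 0ℚ ≤ℚ ind b
ind-nonNeg true  = 0≤1
ind-nonNeg false = ℚ.≤-refl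

filter-≟true : ∀ {A : Set} (p : A → Bool) → L.filter (λ x → p x ≟ᵇ true) ≗ filterᵇ p
filter-≟true p = L.filter-≐ (λ x → p x ≟ᵇ true) (T? ∘ p) (Equivalence.from T-≡ , Equivalence.to T-≡)

length-filterᵇ-tabulate : ∀ {A : Set} {k} (p : A → Bool) (g : Fin k → A) →
                          length (filterᵇ p (L.tabulate g)) ≡ length (filterᵇ (p ∘ g) (allFin k))
length-filterᵇ-tabulate {k = zero}  p g = refl
length-filterᵇ-tabulate {k = suc k} p g with p (g zero)
... | true  = cong suc (trans (length-filterᵇ-tabulate p (g ∘ suc)) (sym (length-filterᵇ-tabulate (p ∘ g) suc)))
... | false = trans (length-filterᵇ-tabulate p (g ∘ suc)) (sym (length-filterᵇ-tabulate (p ∘ g) suc))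

count : ∀ {k} → (Fin k → Bool) → ℕ
count {k} s = length (filterᵇ s (allFin k))

count-used : ∀ {k} (s : Fin (suc k) → Bool) → s zero ≡ true → count s ≡ suc (count (s ∘ suc))
count-used s used rewrite used = cong suc (length-filterᵇ-tabulate s suc)

count-unused : ∀ {k} (s : Fin (suc k) → Bool) → s zero ≡ false → count s ≡ count (s ∘ suc)
count-unused s unused rewrite unused = length-filterᵇ-tabulate s suc

count-cong : ∀ {k} {s s′ : Fin k → Bool} → s ≗ s′ → count s ≡ count s′
count-cong {k} {s} {s′} s≗s′ = cong length
  (L.filter-≐ (T? ∘ s) (T? ∘ s′) ((λ {v} → subst T (s≗s′ v)) , (λ {v} → subst T (sym (s≗s′ v)))) (allFin k))

count-insert : ∀ {k} (a : Fin k) (s : Fin k → Bool) → s a ≡ false →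
               count (λ v → ⌊ a ≟ v ⌋ ∨ s v) ≡ suc (count s)
count-insert zero    s sa≡false =
  trans (count-used (λ v → ⌊ zero ≟ v ⌋ ∨ s v) refl) (cong suc (sym (count-unused s sa≡false)))
count-insert {suc k} (suc a) s sa≡false = cases (s zero) refl
  where
  shifted : count (λ v → ⌊ suc a ≟ suc v ⌋ ∨ s (suc v)) ≡ suc (count (s ∘ suc))
  shifted = trans (count-cong λ v → cong (_∨ s (suc v)) (≟-suc a v)) (count-insert a (s ∘ suc) sa≡false)
  cases : ∀ b → s zero ≡ b → count (λ v → ⌊ suc a ≟ v ⌋ ∨ s v) ≡ suc (count s)
  cases true  s₀ = trans (count-used (λ v → ⌊ suc a ≟ v ⌋ ∨ s v) s₀) (cong suc (trans shifted (sym (count-used s s₀))))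
  cases false s₀ = trans (count-unused (λ v → ⌊ suc a ≟ v ⌋ ∨ s v) s₀) (trans shifted (cong suc (sym (count-unused s s₀))))

-- Finner

module Integration {A : Set} (Y : List A) (μ : A → ℚ) where

  wt : ∀ {k} → (Fin k → A) → ℚ
  wt {k} β = ∏[ i ← allFin k ] μ (β i)

  ∑-allMaps-suc-wt : ∀ k (h : (Fin (suc k) → A) → ℚ) → Extensional h →
                     ∑[ β ← allMaps Y (suc k) ] wt β * h β ≡ ∑[ y ← Y ] μ y * (∑[ β ← allMaps Y k ] wt β * h (cons y β))
  ∑-allMaps-suc-wt k h h-ext =
    trans (∑-allMaps-suc Y k _ (λ β≗β′ → cong₂ _*_ (∏.cong (allFin (suc k)) λ i → cong μ (β≗β′ i)) (h-ext β≗β′)))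
      (∑.cong Y λ y → trans (∑.cong (allMaps Y k) λ β → trans (cong (_* h (cons y β)) (∏.allFin-suc (μ ∘ cons y β)))
                                                              (ℚ.*-assoc (μ y) (wt β) (h (cons y β))))
                            (sym (*-distribˡ-∑ (μ y) (allMaps Y k) _)))

  ∫-free : {X : Set} → ℕ → ((X → ℚ) → ℚ) → (X → A → ℚ) → ℚ
  ∫-free c Φ ψ = ∑[ γ ← allMaps Y c ] wt γ * Φ (λ x → ∏[ i ← allFin c ] ψ x (γ i))

  module Marginal (y₀ : A) where

    -- Integration against μ in the coordinates selected by s; the other coordinates are frozen at y₀.
    ∫[_]_ : ∀ {k} → (Fin k → Bool) → ((Fin k → A) → ℚ) → ℚ
    ∫[_]_ {zero}  s h = h (λ ())
    ∫[_]_ {suc k} s h = if s zero then ∑[ y ← Y ] μ y * ∫[ s ∘ suc ] (h ∘ cons y) else ∫[ s ∘ suc ] (h ∘ cons y₀)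

    ∫-cong : ∀ {k} (s : Fin k → Bool) {h h′ : (Fin k → A) → ℚ} → (∀ β → h β ≡ h′ β) → ∫[ s ] h ≡ ∫[ s ] h′
    ∫-cong {zero}  s h≡h′ = h≡h′ _
    ∫-cong {suc k} s h≡h′ with s zero
    ... | true  = ∑.cong Y λ y → cong (μ y *_) (∫-cong (s ∘ suc) (h≡h′ ∘ cons y))
    ... | false = ∫-cong (s ∘ suc) (h≡h′ ∘ cons y₀)

    ∫-nonNeg : ∀ {k} (s : Fin k → Bool) {h : (Fin k → A) → ℚ} → (∀ y → 0ℚ ≤ℚ μ y) → (∀ β → 0ℚ ≤ℚ h β) → 0ℚ ≤ℚ ∫[ s ] h
    ∫-nonNeg {zero}  s μ≥0 h≥0 = h≥0 _
    ∫-nonNeg {suc k} s μ≥0 h≥0 with s zero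
    ... | true  = ∑-nonNeg Y λ y → *-nonNeg (μ≥0 y) (∫-nonNeg (s ∘ suc) μ≥0 (h≥0 ∘ cons y))
    ... | false = ∫-nonNeg (s ∘ suc) μ≥0 (h≥0 ∘ cons y₀)

    ∫-used : ∀ {k} (s : Fin (suc k) → Bool) (h : (Fin (suc k) → A) → ℚ) → s zero ≡ true →
             ∫[ s ] h ≡ ∑[ y ← Y ] μ y * ∫[ s ∘ suc ] (h ∘ cons y)
    ∫-used s h used rewrite used = refl

    ∫-unused : ∀ {k} (s : Fin (suc k) → Bool) (h : (Fin (suc k) → A) → ℚ) → s zero ≡ false →
               ∫[ s ] h ≡ ∫[ s ∘ suc ] (h ∘ cons y₀)
    ∫-unused s h unused rewrite unused = refl

    -- Finner's inequality with all exponents D + 1 (each coordinate is used by exactly D + 1 factors),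
    -- by induction on the number of coordinates, applying Hölder to the factors that use the first one.
    finner : ∀ D {k m} (S : Fin m → Fin k → Bool) (f : Fin m → (Fin k → A) → ℚ) →
             (∀ j → count (λ a → S a j) ≡ suc D) →
             (∀ y → 0ℚ ≤ℚ μ y) → (∀ a β → 0ℚ ≤ℚ f a β) → (∀ a → DependsOnly (S a) (f a)) →
             (∑[ β ← allMaps Y k ] wt β * (∏[ a ← allFin m ] f a β)) ^ℚ suc D
               ≤ℚ ∏[ a ← allFin m ] ∫[ S a ] (λ β → f a β ^ℚ suc D)
    finner D {zero} {m} S f _ _ _ f-dep = ℚ.≤-reflexive (no-coordinates _)
      where
      no-coordinates : ∀ β₀ → (wt β₀ * (∏[ a ← allFin m ] f a β₀) + 0ℚ) ^ℚ suc D
                              ≡ ∏[ a ← allFin m ] ∫[ S a ] (λ β → f a β ^ℚ suc D)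
      no-coordinates β₀ =
        trans (cong (_^ℚ suc D) (trans (ℚ.+-identityʳ _) (ℚ.*-identityˡ (∏[ a ← allFin m ] f a β₀))))
        (trans (^-distrib-∏ (allFin m) (λ a → f a β₀) (suc D))
               (∏.cong (allFin m) λ a → cong (_^ℚ suc D) (f-dep a λ ())))
    finner D {suc k} {m} S f covered μ≥0 f≥0 f-dep = begin
      (∑[ β ← allMaps Y (suc k) ] wt β * (∏[ a ← allFin m ] f a β)) ^ℚ suc D
        ≡⟨ cong (_^ℚ suc D) (∑-allMaps-suc-wt k _ λ β≗β′ → ∏.cong (allFin m) λ a → f-dep a λ j _ → β≗β′ j) ⟩
      (∑[ y ← Y ] μ y * I y) ^ℚ suc D
        ≤⟨ hölderᴸ Y μ I uses R C (covered zero) μ≥0 I≥0 R≥0 C≥0 (λ y →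
             subst (I y ^ℚ suc D ≤ℚ_) (split y) (induction y)) ⟩
      C * (∏[ a ← uses ] ∑[ y ← Y ] μ y * R a y)
        ≡⟨ trans (∏.if-split (λ a → S a zero) (allFin m) (λ a → ∑[ y ← Y ] μ y * R a y) (λ a → R a y₀))
                 (ℚ.*-comm _ C) ⟨
      ∏[ a ← allFin m ] ∫[ S a ] (λ β → f a β ^ℚ suc D)
        ∎
      where
      open ℚ.≤-Reasoning
      uses ignores : List (Fin m)
      uses    = filterᵇ (λ a → S a zero) (allFin m)
      ignores = filterᵇ (not ∘ (λ a → S a zero)) (allFin m)
      I : A → ℚ
      I y = ∑[ β ← allMaps Y k ] wt β * (∏[ a ← allFin m ] f a (cons y β))
      R : Fin m → A → ℚ
      R a y = ∫[ S a ∘ suc ] (λ β → f a (cons y β) ^ℚ suc D)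
      C = ∏[ a ← ignores ] R a y₀

      I≥0 : ∀ y → 0ℚ ≤ℚ I y
      I≥0 y = ∑-nonNeg (allMaps Y k) λ β → *-nonNeg (∏-nonNeg (allFin k) (μ≥0 ∘ β)) (∏-nonNeg (allFin m) λ a → f≥0 a _)
      R≥0 : ∀ a y → 0ℚ ≤ℚ R a y
      R≥0 a y = ∫-nonNeg (S a ∘ suc) μ≥0 λ β → ^-nonNeg (suc D) (f≥0 a _)
      C≥0 : 0ℚ ≤ℚ C
      C≥0 = ∏-nonNeg ignores λ a → R≥0 a y₀

      induction : ∀ y → I y ^ℚ suc D ≤ℚ ∏[ a ← allFin m ] R a y
      induction y = finner D (λ a → S a ∘ suc) (λ a → f a ∘ cons y) (covered ∘ suc) μ≥0 (λ a β → f≥0 a _)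
        (λ a agree → f-dep a λ { zero _ → refl ; (suc j) used → agree j used })

      frozen : ∀ a → S a zero ≡ false → ∀ y → R a y ≡ R a y₀
      frozen a unused y = ∫-cong (S a ∘ suc) λ β → cong (_^ℚ suc D) (f-dep a λ
        { zero used → contradiction (trans (sym unused) used) λ () ; (suc j) _ → refl })

      split : ∀ y → ∏[ a ← allFin m ] R a y ≡ C * (∏[ a ← uses ] R a y)
      split y = trans (∏.cong (allFin m) R≡) (trans (∏.if-split (λ a → S a zero) (allFin m) (λ a → R a y) (λ a → R a y₀))
                                                    (ℚ.*-comm _ C))
        where
        R≡ : ∀ a → R a y ≡ (if S a zero then R a y else R a y₀)
        R≡ a with S a zero in eq
        ... | true  = refl
        ... | false = frozen a eq y

    ∫-product : ∀ {X : Set} {k} (s : Fin k → Bool) (Φ : (X → ℚ) → ℚ) → (∀ {F G} → F ≗ G → Φ F ≡ Φ G) →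
                (ψ : X → A → ℚ) →
                ∫[ s ] (λ β → Φ (λ x → ∏[ v ← allFin k ] ψ x (β v) ^ᵇ s v)) ≡ ∫-free (count s) Φ ψ
    ∫-product {k = zero}      s Φ Φ-ext ψ = sym (trans (ℚ.+-identityʳ _) (ℚ.*-identityˡ _))
    ∫-product {X} {k = suc k} s Φ Φ-ext ψ = cases (s zero) refl
      where
      open ≡-Reasoning
      product-form : (Fin (suc k) → A) → ℚ
      product-form β = Φ (λ x → ∏[ v ← allFin (suc k) ] ψ x (β v) ^ᵇ s v)
      rest : (Fin k → A) → X → ℚ
      rest β x = ∏[ v ← allFin k ] ψ x (β v) ^ᵇ s (suc v)
      peel : ∀ y β x → ∏[ v ← allFin (suc k) ] ψ x (cons y β v) ^ᵇ s v ≡ ψ x y ^ᵇ s zero * rest β x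
      peel y β x = ∏.allFin-suc (λ v → ψ x (cons y β v) ^ᵇ s v)
      c′ = count (s ∘ suc)
      cases : ∀ b → s zero ≡ b → ∫[ s ] product-form ≡ ∫-free (count s) Φ ψ
      cases true used = begin
        ∫[ s ] product-form
          ≡⟨ ∫-used s product-form used ⟩
        ∑[ y ← Y ] μ y * ∫[ s ∘ suc ] (product-form ∘ cons y)
          ≡⟨ ∑.cong Y (λ y → cong (μ y *_) (∫-cong (s ∘ suc) λ β → Φ-ext λ x →
               trans (peel y β x) (cong (λ b → ψ x y ^ᵇ b * rest β x) used))) ⟩
        ∑[ y ← Y ] μ y * ∫[ s ∘ suc ] (λ β → Φ (λ x → ψ x y * rest β x))
          ≡⟨ ∑.cong Y (λ y → cong (μ y *_) (∫-product (s ∘ suc) (λ F → Φ (λ x → ψ x y * F x))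
               (λ F≗G → Φ-ext λ x → cong (ψ x y *_) (F≗G x)) ψ)) ⟩
        ∑[ y ← Y ] μ y * ∫-free c′ (λ F → Φ (λ x → ψ x y * F x)) ψ
          ≡⟨ trans (∑-allMaps-suc-wt c′ (λ γ → Φ (λ x → ∏[ i ← allFin (suc c′) ] ψ x (γ i)))
                                    (λ γ≗γ′ → Φ-ext λ x → ∏.cong (allFin (suc c′)) λ i → cong (ψ x) (γ≗γ′ i)))
                   (∑.cong Y λ y → cong (μ y *_) (∑.cong (allMaps Y c′) λ γ → cong (wt γ *_)
                     (Φ-ext λ x → ∏.allFin-suc (λ i → ψ x (cons y γ i))))) ⟨
        ∫-free (suc c′) Φ ψ
          ≡⟨ cong (λ c → ∫-free c Φ ψ) (count-used s used) ⟨
        ∫-free (count s) Φ ψ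
          ∎
      cases false unused = begin
        ∫[ s ] product-form
          ≡⟨ ∫-unused s product-form unused ⟩
        ∫[ s ∘ suc ] (product-form ∘ cons y₀)
          ≡⟨ ∫-cong (s ∘ suc) (λ β → Φ-ext λ x →
               trans (peel y₀ β x) (trans (cong (λ b → ψ x y₀ ^ᵇ b * rest β x) unused) (ℚ.*-identityˡ (rest β x)))) ⟩
        ∫[ s ∘ suc ] (λ β → Φ (rest β))
          ≡⟨ ∫-product (s ∘ suc) Φ Φ-ext ψ ⟩
        ∫-free c′ Φ ψ
          ≡⟨ cong (λ c → ∫-free c Φ ψ) (count-unused s unused) ⟨
        ∫-free (count s) Φ ψ
          ∎

-- The partition function of H̃

closedNbhd : ∀ {n} → SimpleGraph n → Fin n → Fin n → Bool
closedNbhd G a v = ⌊ a ≟ v ⌋ ∨ adj G a v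

closedNbhd-sym : ∀ {n} (G : SimpleGraph n) a v → closedNbhd G a v ≡ closedNbhd G v a
closedNbhd-sym G a v = cong₂ _∨_ (≟-sym a v) (adj-sym G a v)
  where
  ≟-sym : ∀ {n} (a v : Fin n) → ⌊ a ≟ v ⌋ ≡ ⌊ v ≟ a ⌋
  ≟-sym a v with a ≟ v | v ≟ a
  ... | yes _   | yes _   = refl
  ... | no  _   | no  _   = refl
  ... | yes a≡v | no  v≢a = contradiction (sym a≡v) v≢a
  ... | no  a≢v | yes v≡a = contradiction (sym v≡a) a≢v

count-closedNbhd : ∀ {n} (G : SimpleGraph n) a → count (closedNbhd G a) ≡ suc (degree G a)
count-closedNbhd {n} G a = trans (count-insert a (adj G a) (adj-irrefl G a))
  (cong (suc ∘ length) (sym (filter-≟true (adj G a) (allFin n))))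

closedNbhd-complete : ∀ {m} (a v : Fin m) → closedNbhd (complete m) a v ≡ true
closedNbhd-complete a v with a ≟ v
... | yes _ = refl
... | no  _ = refl

hom-weight : ∀ {n} → SimpleGraph n → (F : WGraph) → (Fin n → V F) → ℚ
hom-weight {n} G F φ = (∏[ u ← allFin n ] ∏[ v ← allFin n ] ind (adjF F (φ u) (φ v)) ^ᵇ adj G u v)
                     * (∏[ w ← allFin n ] weight F (φ w))

hom-weight-ext : ∀ {n} (G : SimpleGraph n) F → Extensional (hom-weight G F)
hom-weight-ext {n} G F φ≗φ′ = cong₂ _*_
  (∏.cong (allFin n) λ u → ∏.cong (allFin n) λ v → cong₂ (λ x y → ind (adjF F x y) ^ᵇ adj G u v) (φ≗φ′ u) (φ≗φ′ v))
  (∏.cong (allFin n) λ w → cong (weight F) (φ≗φ′ w))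

Z-as-∑ : ∀ {n} (G : SimpleGraph n) F → Z G F ≡ ∑[ φ ← allMaps (verts F) n ] hom-weight G F φ
Z-as-∑ {n} G F = ∑.cong (allMaps (verts F) n) λ φ → cong (_* (∏[ w ← allFin n ] weight F (φ w))) (begin
  prodℚ (edges φ)                                         ≡⟨ cong (foldr _*_ 1ℚ) (L.map-id (edges φ)) ⟨
  ∏ (edges φ) id                                          ≡⟨ ∏.concatMap (λ u → L.map (edge φ u) (allFin n)) (allFin n) id ⟩
  ∏[ u ← allFin n ] ∏ (L.map (edge φ u) (allFin n)) id    ≡⟨ ∏.cong (allFin n) (λ u → ∏.map (edge φ u) (allFin n) id) ⟩
  ∏[ u ← allFin n ] ∏[ v ← allFin n ] edge φ u v          ∎)
  where
  open ≡-Reasoning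
  edge : (Fin n → V F) → Fin n → Fin n → ℚ
  edge φ u v = ind (adjF F (φ u) (φ v)) ^ᵇ adj G u v
  edges : (Fin n → V F) → List ℚ
  edges φ = L.concatMap (λ u → L.map (edge φ u) (allFin n)) (allFin n)

Z-nonNeg : ∀ {n} (G : SimpleGraph n) F → (∀ x → 0ℚ ≤ℚ weight F x) → 0ℚ ≤ℚ Z G F
Z-nonNeg {n} G F weight≥0 = subst (0ℚ ≤ℚ_) (sym (Z-as-∑ G F)) (∑-nonNeg (allMaps (verts F) n) λ φ →
  *-nonNeg (∏-nonNeg (allFin n) λ u → ∏-nonNeg (allFin n) λ v →
              ^ᵇ-nonNeg (adj G u v) (ind-nonNeg (adjF F (φ u) (φ v))))
           (∏-nonNeg (allFin n) (weight≥0 ∘ φ)))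

module _ (p q : ℕ) (E : Fin p → Fin q → Bool) (νA : Fin p → ℚ) (νB : Fin q → ℚ) where

  H̃ : WGraph
  H̃ = Htilde p q E νA νB

  open Integration (allFin q) νB using (wt; ∫-free; module Marginal)

  fibre : ∀ {n} → SimpleGraph n → Fin n → (Fin n → Fin q) → ℚ
  fibre {n} G a β = ∑[ x ← allFin p ] νA x * (∏[ v ← allFin n ] ind (E x (β v)) ^ᵇ closedNbhd G a v)

  -- φ = ⟨α, β⟩ lands in V(H̃) iff E (α v) (β v) for all v, and the H̃-edge condition at u ~ v is
  -- E (α u) (β v) ∧ E (α v) (β u); each conjunct occurs twice among ordered pairs and is idempotent.
  hom-weight-factorises : ∀ {n} (G : SimpleGraph n) (α : Fin n → Fin p) (β : Fin n → Fin q) →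
    (∏[ v ← allFin n ] ind (E (α v) (β v))) * hom-weight G H̃ < α , β >
      ≡ wt β * (∏[ a ← allFin n ] νA (α a) * (∏[ v ← allFin n ] ind (E (α a) (β v)) ^ᵇ closedNbhd G a v))
  hom-weight-factorises {n} G α β = begin
    diagonal * ((∏[ u ← allFin n ] ∏[ v ← allFin n ] ind (E (α u) (β v) ∧ E (α v) (β u)) ^ᵇ adj G u v)
                * (∏[ w ← allFin n ] νA (α w) * νB (β w)))
      ≡⟨ cong (diagonal *_) (cong₂ _*_ edges (∏.distrib (allFin n) (νA ∘ α) (νB ∘ β))) ⟩
    diagonal * (offDiagonal * (weightA * wt β))
      ≡⟨ solve 4 (λ D X A B → D :* (X :* (A :* B)) := B :* (A :* (D :* X))) refl diagonal offDiagonal weightA (wt β) ⟩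
    wt β * (weightA * (diagonal * offDiagonal))
      ≡⟨ cong (wt β *_) (trans (∏.distrib (allFin n) (νA ∘ α) (λ a → e a a * neighbours a))
                              (cong (weightA *_) (∏.distrib (allFin n) (λ a → e a a) neighbours))) ⟨
    wt β * (∏[ a ← allFin n ] νA (α a) * (e a a * neighbours a))
      ≡⟨ cong (wt β *_) (∏.cong (allFin n) λ a → cong (νA (α a) *_) (closed a)) ⟨
    wt β * (∏[ a ← allFin n ] νA (α a) * (∏[ v ← allFin n ] e a v ^ᵇ closedNbhd G a v))
      ∎
    where
    open ≡-Reasoning
    e : Fin n → Fin n → ℚ
    e u v = ind (E (α u) (β v))
    neighbours : Fin n → ℚ
    neighbours u = ∏[ v ← allFin n ] e u v ^ᵇ adj G u v
    diagonal offDiagonal weightA : ℚ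
    diagonal    = ∏[ v ← allFin n ] e v v
    offDiagonal = ∏[ u ← allFin n ] neighbours u
    weightA     = ∏[ w ← allFin n ] νA (α w)

    transposed : (∏[ u ← allFin n ] ∏[ v ← allFin n ] e v u ^ᵇ adj G u v) ≡ offDiagonal
    transposed = trans (∏.comm (allFin n) (allFin n) λ u v → e v u ^ᵇ adj G u v)
                       (∏.cong (allFin n) λ v → ∏.cong (allFin n) λ u → cong (e v u ^ᵇ_) (adj-sym G u v))

    edges : (∏[ u ← allFin n ] ∏[ v ← allFin n ] ind (E (α u) (β v) ∧ E (α v) (β u)) ^ᵇ adj G u v) ≡ offDiagonal
    edges = begin
      (∏[ u ← allFin n ] ∏[ v ← allFin n ] ind (E (α u) (β v) ∧ E (α v) (β u)) ^ᵇ adj G u v)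
        ≡⟨ ∏.cong (allFin n) (λ u → ∏.cong (allFin n) λ v →
             trans (cong (_^ᵇ adj G u v) (ind-∧ (E (α u) (β v)) (E (α v) (β u))))
                   (^ᵇ-distribʳ-* (e u v) (e v u) (adj G u v))) ⟩
      (∏[ u ← allFin n ] ∏[ v ← allFin n ] e u v ^ᵇ adj G u v * e v u ^ᵇ adj G u v)
        ≡⟨ ∏.cong (allFin n) (λ u → ∏.distrib (allFin n) (λ v → e u v ^ᵇ adj G u v) (λ v → e v u ^ᵇ adj G u v)) ⟩
      (∏[ u ← allFin n ] neighbours u * (∏[ v ← allFin n ] e v u ^ᵇ adj G u v))
        ≡⟨ ∏.distrib (allFin n) neighbours _ ⟩
      offDiagonal * (∏[ u ← allFin n ] ∏[ v ← allFin n ] e v u ^ᵇ adj G u v)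
        ≡⟨ cong (offDiagonal *_) transposed ⟩
      offDiagonal * offDiagonal
        ≡⟨ ∏-idem (allFin n) neighbours (λ u → ∏-idem (allFin n) _ λ v →
             ^ᵇ-idem (ind-idem (E (α u) (β v))) (adj G u v)) ⟩
      offDiagonal ∎

    closed : ∀ a → ∏[ v ← allFin n ] e a v ^ᵇ closedNbhd G a v ≡ e a a * neighbours a
    closed a = trans (∏.cong (allFin n) λ v → ^ᵇ-∨ (ind-idem (E (α a) (β v))) ⌊ a ≟ v ⌋ (adj G a v))
                     (trans (∏.distrib (allFin n) (λ v → e a v ^ᵇ ⌊ a ≟ v ⌋) (λ v → e a v ^ᵇ adj G a v))
                            (cong (_* neighbours a) (∏-^ᵇ-≟ a (e a))))

  Z-factorises : ∀ {n} (G : SimpleGraph n) →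
                 Z G H̃ ≡ ∑[ β ← allMaps (allFin q) n ] wt β * (∏[ a ← allFin n ] fibre G a β)
  Z-factorises {n} G = begin
    Z G H̃
      ≡⟨ Z-as-∑ G H̃ ⟩
    ∑[ φ ← allMaps (verts H̃) n ] hom-weight G H̃ φ
      ≡⟨ cong (λ Y → ∑[ φ ← allMaps Y n ] hom-weight G H̃ φ) (filter-≟true (uncurry E) pairs) ⟩
    ∑[ φ ← allMaps (filterᵇ (uncurry E) pairs) n ] hom-weight G H̃ φ
      ≡⟨ ∑-allMaps-filterᵇ (uncurry E) pairs n (hom-weight G H̃) (hom-weight-ext G H̃) ⟩
    ∑[ φ ← allMaps pairs n ] (∏[ v ← allFin n ] ind (uncurry E (φ v))) * hom-weight G H̃ φ
      ≡⟨ ∑-allMaps-cartesianProduct (allFin p) (allFin q) n _ (λ φ≗φ′ →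
           cong₂ _*_ (∏.cong (allFin n) λ v → cong (ind ∘ uncurry E) (φ≗φ′ v)) (hom-weight-ext G H̃ φ≗φ′)) ⟩
    ∑[ α ← allMaps (allFin p) n ] ∑[ β ← allMaps (allFin q) n ]
      (∏[ v ← allFin n ] ind (E (α v) (β v))) * hom-weight G H̃ < α , β >
      ≡⟨ ∑.cong (allMaps (allFin p) n) (λ α → ∑.cong (allMaps (allFin q) n) λ β → hom-weight-factorises G α β) ⟩
    ∑[ α ← allMaps (allFin p) n ] ∑[ β ← allMaps (allFin q) n ] wt β * (∏[ a ← allFin n ] labelWeight a (α a) β)
      ≡⟨ ∑.comm (allMaps (allFin p) n) (allMaps (allFin q) n) _ ⟩
    ∑[ β ← allMaps (allFin q) n ] ∑[ α ← allMaps (allFin p) n ] wt β * (∏[ a ← allFin n ] labelWeight a (α a) β)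
      ≡⟨ ∑.cong (allMaps (allFin q) n) (λ β → *-distribˡ-∑ (wt β) (allMaps (allFin p) n) _) ⟨
    ∑[ β ← allMaps (allFin q) n ] wt β * (∑[ α ← allMaps (allFin p) n ] ∏[ a ← allFin n ] labelWeight a (α a) β)
      ≡⟨ ∑.cong (allMaps (allFin q) n) (λ β → cong (wt β *_) (∏∑≡∑∏ (allFin p) n λ a x → labelWeight a x β)) ⟨
    ∑[ β ← allMaps (allFin q) n ] wt β * (∏[ a ← allFin n ] fibre G a β)
      ∎
    where
    open ≡-Reasoning
    pairs = L.cartesianProduct (allFin p) (allFin q)
    labelWeight : Fin n → Fin p → (Fin n → Fin q) → ℚ
    labelWeight a x β = νA x * (∏[ v ← allFin n ] ind (E x (β v)) ^ᵇ closedNbhd G a v)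

  fibre-dependsOnly : ∀ {n} (G : SimpleGraph n) a → DependsOnly (closedNbhd G a) (fibre G a)
  fibre-dependsOnly {n} G a agree = ∑.cong (allFin p) λ x → cong (νA x *_) (∏.cong (allFin n) λ v →
    ^ᵇ-cong (closedNbhd G a v) λ v∈N[a] → cong (ind ∘ E x) (agree v v∈N[a]))

  fibre-nonNeg : (∀ x → 0ℚ ≤ℚ νA x) → ∀ {n} (G : SimpleGraph n) a β → 0ℚ ≤ℚ fibre G a β
  fibre-nonNeg νA≥0 {n} G a β = ∑-nonNeg (allFin p) λ x →
    *-nonNeg (νA≥0 x) (∏-nonNeg (allFin n) λ v → ^ᵇ-nonNeg (closedNbhd G a v) (ind-nonNeg (E x (β v))))

  module _ (d : ℕ) where

    Φ : (Fin p → ℚ) → ℚ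
    Φ F = (∑[ x ← allFin p ] νA x * F x) ^ℚ suc d

    Φ-ext : ∀ {F G} → F ≗ G → Φ F ≡ Φ G
    Φ-ext F≗G = cong (_^ℚ suc d) (∑.cong (allFin p) λ x → cong (νA x *_) (F≗G x))

    ψ : Fin p → Fin q → ℚ
    ψ x y = ind (E x y)

    Z-complete : Z (complete (suc d)) H̃ ≡ ∫-free (suc d) Φ ψ
    Z-complete = trans (Z-factorises (complete (suc d))) (∑.cong (allMaps (allFin q) (suc d)) λ γ → cong (wt γ *_)
      (trans (∏.cong (allFin (suc d)) λ a → ∑.cong (allFin p) λ x → cong (νA x *_) (∏.cong (allFin (suc d)) λ v →
                cong (ψ x (γ v) ^ᵇ_) (closedNbhd-complete a v)))
             (∏-const (suc d) (∑[ x ← allFin p ] νA x * (∏[ i ← allFin (suc d) ] ψ x (γ i))))))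

    module _ (y₀ : Fin q) where
      open Marginal y₀

      ∫-fibre : ∀ {n} (G : SimpleGraph n) a → degree G a ≡ d →
                ∫[ closedNbhd G a ] (λ β → fibre G a β ^ℚ suc d) ≡ Z (complete (suc d)) H̃
      ∫-fibre G a deg≡d = trans (∫-product (closedNbhd G a) Φ Φ-ext ψ)
        (trans (cong (λ c → ∫-free c Φ ψ) (trans (count-closedNbhd G a) (cong suc deg≡d))) (sym Z-complete))

      Z-regular-bound : (∀ x → 0ℚ ≤ℚ νA x) → (∀ y → 0ℚ ≤ℚ νB y) → ∀ n (G : SimpleGraph n) → Regular d G →
                        Z G H̃ ^ℚ suc d ≤ℚ Z (complete (suc d)) H̃ ^ℚ n
      Z-regular-bound νA≥0 νB≥0 n G regular = begin
        Z G H̃ ^ℚ suc d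
          ≡⟨ cong (_^ℚ suc d) (Z-factorises G) ⟩
        (∑[ β ← allMaps (allFin q) n ] wt β * (∏[ a ← allFin n ] fibre G a β)) ^ℚ suc d
          ≤⟨ finner d (closedNbhd G) (fibre G) covered νB≥0 (fibre-nonNeg νA≥0 G) (fibre-dependsOnly G) ⟩
        ∏[ a ← allFin n ] ∫[ closedNbhd G a ] (λ β → fibre G a β ^ℚ suc d)
          ≡⟨ ∏.cong (allFin n) (λ a → ∫-fibre G a (regular a)) ⟩
        ∏[ a ← allFin n ] Z (complete (suc d)) H̃
          ≡⟨ ∏-const n (Z (complete (suc d)) H̃) ⟩
        Z (complete (suc d)) H̃ ^ℚ n ∎
        where
        open ℚ.≤-Reasoning
        covered : ∀ j → count (λ a → closedNbhd G a j) ≡ suc d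
        covered j =
          trans (count-cong (λ a → closedNbhd-sym G a j)) (trans (count-closedNbhd G j) (cong suc (regular j)))

theorem4 : (p q : ℕ) (E : Fin p → Fin q → Bool)
           (νA : Fin p → ℚ) (νB : Fin q → ℚ) →
           (∀ a → 0ℚ ≤ℚ νA a) → (∀ b → 0ℚ ≤ℚ νB b) →
           (d : ℕ) → 1 ≤ d → (n : ℕ) (G : SimpleGraph n) → Regular d G →
           (Z G (Htilde p q E νA νB)) ^ℚ (suc d)
             ≤ℚ (Z (complete (suc d)) (Htilde p q E νA νB)) ^ℚ n
-- Finner's marginals freeze unused coordinates at a B-label
-- (zero below); without B-labels Z G H̃ is 1 for the empty graph and 0 otherwise.
theorem4 p (suc q) E νA νB νA≥0 νB≥0 d _ n G regular =
  Z-regular-bound p (suc q) E νA νB d zero νA≥0 νB≥0 n G regular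
theorem4 p zero    E νA νB νA≥0 νB≥0 d _ zero G _ = ℚ.≤-reflexive (1^n≡1 (suc d))
theorem4 p zero    E νA νB νA≥0 νB≥0 d _ (suc n) G _ =
  subst (_≤ℚ Z (complete (suc d)) H̃′ ^ℚ suc n)
    (sym (trans (cong (_^ℚ suc d) no-B-labels) (ℚ.*-zeroˡ (0ℚ ^ℚ d))))
    (^-nonNeg (suc n) (Z-nonNeg (complete (suc d)) H̃′ λ ab → *-nonNeg (νA≥0 _) (νB≥0 _)))
  where
  H̃′ = Htilde p zero E νA νB
  no-B-labels : Z G H̃′ ≡ 0ℚ
  no-B-labels = Z-factorises p zero E νA νB G
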